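{- Let $T$ be a $\{1,3\}$-tree and let $w,w'$ be two distinct vertices of $\mathcal{P}_T$, written $w=\frac12\mathbbm{1}_{H_w}$ and $w'=\frac12\mathbbm{1}_{H_{w'}}$ where $H_w,H_{w'}$ are collections of pairwise vertex-disjoint leaf-paths. Then $w$ and $w'$ are adjacent in the $1$-skeleton of $\mathcal{P}_T$ if and only if the symmetric difference of the edge sets of $H_w$ and $H_{w'}$ is the edge set of a single leaf-path.
   Context: A $\{1,3\}$-tree is a finite tree all of whose nodes have degree $1$ (leaves) or $3$ (internal nodes). A leaf-edge is an edge incident with a leaf; a leaf-path is a path in $T$ whose two extreme edges are leaf-edges (a single edge joining two leaves is a leaf-path). $\mathbbm{1}_H$ is the characteristic vector of the edge set of $H$. With $E$ the edge set, $\mathcal{P}_T\subset\mathbb{R}^E$ is the set of $w$ such that for every internal node $v$ with incident edges $a,b,c$: $w_a\le w_b+w_c$, $w_b\le w_a+w_c$, $w_c\le w_a+w_b$, $w_a+w_b+w_c\le1$; and if $T$ is a single edge $e$, $\mathcal{P}_T=\{w:0\le w_e\le\frac12\}$. Every vertex of $\mathcal{P}_T$ is of the form $\frac12\mathbbm{1}_H$ for a unique such collection $H$.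
   Formalization: The polytope $\mathcal{P}_T$ is taken in ℚ^E rather than ℝ^E, so its vertices and adjacency are defined through rational points, rational exposing functionals and rational segment parameters. -}

module Defs where

open import Data.Nat using (ℕ)
open import Data.Fin using (Fin; _≟_)
open import Data.List using (List; []; _∷_; _++_; length; filter; foldr; allFin)
open import Data.List.Membership.Propositional using (_∈_; _∉_)
open import Data.List.Relation.Unary.Any using (Any)
open import Data.List.Relation.Unary.AllPairs using (AllPairs)
open import Data.List.Relation.Unary.Unique.Propositional using (Unique)
open import Data.Product using (_×_; Σ; ∃; ∃₂; _,_)
open import Data.Sum using (_⊎_)
open import Data.Rational using (ℚ; 0ℚ; 1ℚ; ½; _≤_; _+_; _*_; _-_)
open import Relation.Binary.PropositionalEquality using (_≡_; _≢_)
open import Relation.Nullary using (¬_; Dec)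
open import Relation.Nullary.Decidable using (_⊎-dec_)

record Graph : Set where
  field
    nV nE : ℕ
    src tgt : Fin nE → Fin nV

module _ (G : Graph) where
  open Graph G

  V : Set
  V = Fin nV

  E : Set
  E = Fin nE

  Incident : E → V → Set
  Incident e v = src e ≡ v ⊎ tgt e ≡ v

  incident? : (e : E) (v : V) → Dec (Incident e v)
  incident? e v = (src e ≟ v) ⊎-dec (tgt e ≟ v)

  degree : V → ℕ
  degree v = length (filter (λ e → incident? e v) (allFin nE))

  Joins : E → V → V → Set
  Joins e u w = (src e ≡ u × tgt e ≡ w) ⊎ (src e ≡ w × tgt e ≡ u)

  data Walk : V → V → Set where
    []   : ∀ {v} → Walk v v
    step : ∀ {u w x} (e : E) → Joins e u w → Walk w x → Walk u x

  walkEdges : ∀ {u v} → Walk u v → List E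
  walkEdges []             = []
  walkEdges (step e _ p)   = e ∷ walkEdges p

  walkVertices : ∀ {u v} → Walk u v → List V
  walkVertices {v = v} []   = v ∷ []
  walkVertices {u = u} (step e _ p) = u ∷ walkVertices p

  Connected : Set
  Connected = ∀ u v → Walk u v

  Acyclic : Set
  Acyclic = ∀ v (c : Walk v v) → Unique (walkEdges c) → walkEdges c ≡ []

  IsTree : Set
  IsTree = Connected × Acyclic

  Is13Tree : Set
  Is13Tree = IsTree × (∀ v → degree v ≡ 1 ⊎ degree v ≡ 3)

  Leaf : V → Set
  Leaf v = degree v ≡ 1

  LeafEdge : E → Set
  LeafEdge e = ∃ λ v → Incident e v × Leaf v

  record LeafPath : Set where
    field
      {start end} : V
      walk     : Walk start end
      isPath   : Unique (walkVertices walk)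
      firstLeafEdge : ∃₂ λ e es → walkEdges walk ≡ e ∷ es × LeafEdge e
      lastLeafEdge  : ∃₂ λ es e → walkEdges walk ≡ es ++ e ∷ [] × LeafEdge e

  pathEdges : LeafPath → List E
  pathEdges P = walkEdges (LeafPath.walk P)

  pathVertices : LeafPath → List V
  pathVertices P = walkVertices (LeafPath.walk P)

  VertexDisjoint : LeafPath → LeafPath → Set
  VertexDisjoint P Q = ∀ v → v ∈ pathVertices P → v ∉ pathVertices Q

  DisjointLeafPaths : List LeafPath → Set
  DisjointLeafPaths H = AllPairs VertexDisjoint H

  InEdges : List LeafPath → E → Set
  InEdges H e = Any (λ P → e ∈ pathEdges P) H

  Vector : Set
  Vector = E → ℚ

  IsHalfIndicator : Vector → List LeafPath → Set
  IsHalfIndicator w H = ∀ e → (InEdges H e → w e ≡ ½) × (¬ InEdges H e → w e ≡ 0ℚ)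

  InPT : Vector → Set
  InPT w =
    (nE ≡ 1 → ∀ e → (0ℚ ≤ w e) × (w e ≤ ½)) ×
    (∀ v → degree v ≡ 3 → ∀ a b c → a ≢ b → a ≢ c → b ≢ c →
       Incident a v → Incident b v → Incident c v →
       (w a ≤ w b + w c) × (w b ≤ w a + w c) × (w c ≤ w a + w b) ×
       (w a + w b + w c ≤ 1ℚ))

  dot : Vector → Vector → ℚ
  dot c x = foldr (λ e acc → c e * x e + acc) 0ℚ (allFin nE)

  IsVertexPT : Vector → Set
  IsVertexPT w = InPT w × ∃ λ c →
    ∀ x → InPT x → (dot c x ≤ dot c w) × (dot c x ≡ dot c w → ∀ e → x e ≡ w e)

  InSegment : Vector → Vector → Vector → Set
  InSegment w w' x = ∃ λ t → (0ℚ ≤ t) × (t ≤ 1ℚ) × (∀ e → x e ≡ (1ℚ - t) * w e + t * w' e)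

  Adjacent : Vector → Vector → Set
  Adjacent w w' = ∃ λ c →
    (∀ x → InPT x → dot c x ≤ dot c w) × (dot c w ≡ dot c w') ×
    (∀ x → InPT x → dot c x ≡ dot c w → InSegment w w' x)

  Xor : Set → Set → Set
  Xor A B = (A × ¬ B) ⊎ (¬ A × B)

-- Write Δ for the symmetric difference of the edge sets of H and H′.  At an internal node the
-- triangle inequalities leave a half-integral point of P_T either no edge or exactly two edges
-- of value ½, so Δ meets every internal node in 0 or 2 edges.
--
-- If Δ is the edge set of a leaf-path, the functional that is 1 on H ∩ H′, −1 off H ∪ H′ and 0
-- on Δ is maximised by w and w′.  A maximiser x agrees with w off Δ, and at each internal node
-- of the path the third edge lies off Δ, so the triangle inequalities there carry the position
-- of x between w and w′ from one path edge to the next: x lies on the segment [w, w′].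
--
-- Conversely, following Δ from one of its edges through internal nodes, where it continues
-- uniquely, gives a leaf-path P ⊆ Δ containing every edge of Δ at its nodes.  Exchanging w and
-- w′ on P yields two points of P_T with sum w + w′, so if [w, w′] is a face both are optimal
-- and lie on it.  An edge of Δ off P would then force the segment parameter to be 0, while the
-- edges of P force it to be 1; hence P = Δ.

module Submission where

open import Defs
open import Algebra.Bundles using (CommutativeRing)
open import Algebra.Properties.CommutativeSemigroup using (interchange)
open import Data.Bool using (Bool; true; false; not; _xor_; if_then_else_)
open import Data.Bool.Properties using (xor-∧-commutativeRing; ¬-not; not-involutive)
open import Data.Fin as Fin using (Fin) renaming (_≟_ to _≟ᶠ_)
open import Data.Fin.Properties using (pigeonhole; <⇒≢; ¬∀⟶∃¬)
open import Data.Nat as ℕ using (zero; suc)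
import Data.Nat.Properties as ℕₚ
open import Data.List using (List; []; _∷_; _++_; length; filter; allFin; lookup; foldr)
open import Data.List.Membership.Propositional using (_∈_; _∉_)
open import Data.List.Membership.Propositional.Properties
  using (∈-filter⁺; ∈-filter⁻; ∈-allFin; ∈-lookup; ∈-++⁺ʳ)
open import Data.List.Relation.Unary.All as All using (All; []; _∷_)
open import Data.List.Relation.Unary.All.Properties using (¬Any⇒All¬)
open import Data.List.Relation.Unary.AllPairs as AllPairs using ([]; _∷_)
open import Data.List.Relation.Unary.Any using (here; there; any?)
open import Data.List.Relation.Unary.Unique.Propositional using (Unique)
open import Data.List.Relation.Unary.Unique.Propositional.Properties using (allFin⁺; filter⁺)
open import Data.Product using (_×_; Σ; ∃; _,_; proj₁; proj₂)
open import Data.Rational using (ℚ; 0ℚ; 1ℚ; ½; _≤_; _+_; _*_; _-_; -_)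
open import Data.Rational.Properties
  using (≤-refl; ≤-reflexive; ≤-antisym; +-mono-≤; +-comm; +-identityˡ; +-identityʳ;
         *-monoˡ-≤-nonNeg; *-monoˡ-≤-nonPos; *-identityˡ; *-zeroˡ; _≤?_; module ≤-Reasoning)
  renaming (_≟_ to _≟ℚ_)
open import Data.Rational.Solver using (module +-*-Solver)
import Data.Sum as Sum
open import Data.Sum using (_⊎_; inj₁; inj₂)
open import Function using (_∘_)
open import Function.Bundles using (_⇔_; mk⇔; Equivalence)
open import Relation.Binary.PropositionalEquality
open import Relation.Nullary using (¬_; Dec; yes; no; does; contradiction)
open import Relation.Nullary.Decidable using (from-no)

open +-*-Solver using (solve; _:=_; _:+_; _:*_; _:-_; :-_; con)

-- Parity

xor-interchange : ∀ a b c d → (a xor b) xor (c xor d) ≡ (a xor c) xor (b xor d)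
xor-interchange = interchange (CommutativeRing.+-commutativeSemigroup xor-∧-commutativeRing)

xor-even : ∀ {a b c a' b' c'} → a xor b xor c ≡ false → a' xor b' xor c' ≡ false →
  (a xor a') xor (b xor b') xor (c xor c') ≡ false
xor-even {a} {b} {c} {a'} {b'} {c'} even even' = begin
  (a xor a') xor (b xor b') xor (c xor c')   ≡⟨ cong ((a xor a') xor_) (xor-interchange b b' c c') ⟩
  (a xor a') xor (b xor c) xor (b' xor c')   ≡⟨ xor-interchange a a' (b xor c) (b' xor c') ⟩
  (a xor b xor c) xor (a' xor b' xor c')     ≡⟨ cong₂ _xor_ even even' ⟩
  false                                      ∎
  where open ≡-Reasoning

xor-false⇒≡ : ∀ {a b} → a xor b ≡ false → a ≡ b
xor-false⇒≡ {false} {false} _ = refl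
xor-false⇒≡ {true}  {true}  _ = refl

xor-true⇒not : ∀ {a b} → a xor b ≡ true → b ≡ not a
xor-true⇒not {false} {true}  _ = refl
xor-true⇒not {true}  {false} _ = refl

even-true⇒odd : ∀ {a b c} → a xor b xor c ≡ false → a ≡ true → b xor c ≡ true
even-true⇒odd {true} {b} {c} even refl = trans (sym (not-involutive (b xor c))) (cong not even)

even-true-true⇒false : ∀ {a b c} → a xor b xor c ≡ false → a ≡ true → b ≡ true → c ≡ false
even-true-true⇒false {true} {true} {false} _ _ _ = refl

-- Rational arithmetic

+-cancelʳ-≤ : ∀ c {a b} → a + c ≤ b + c → a ≤ b
+-cancelʳ-≤ c {a} {b} le = subst₂ _≤_ (cancel a) (cancel b) (+-mono-≤ le (≤-refl { - c}))
  where
  cancel : ∀ x → x + c + - c ≡ x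
  cancel x = solve 2 (λ x c → x :+ c :+ (:- c) := x) refl x c

+-mono-≤-tightˡ : ∀ {a b c d} → a ≤ b → c ≤ d → a + c ≡ b + d → a ≡ b
+-mono-≤-tightˡ {a} {b} {c} {d} a≤b c≤d eq = ≤-antisym a≤b (+-cancelʳ-≤ d (begin
  b + d ≡⟨ sym eq ⟩
  a + c ≤⟨ +-mono-≤ (≤-refl {a}) c≤d ⟩
  a + d ∎))
  where open ≤-Reasoning

double-cancel-≤ : ∀ {a b} → a + a ≤ b + b → a ≤ b
double-cancel-≤ {a} {b} le = subst₂ _≤_ (halve a) (halve b) (*-monoˡ-≤-nonNeg ½ le)
  where
  halve : ∀ x → ½ * (x + x) ≡ x
  halve x = solve 1 (λ x → con ½ :* (x :+ x) := x) refl x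

p≤q⇒0≤q-p : ∀ {p q} → p ≤ q → 0ℚ ≤ q - p
p≤q⇒0≤q-p {p} {q} p≤q =
  +-cancelʳ-≤ p (subst₂ _≤_ (sym (+-identityˡ p)) (solve 2 (λ p q → q := q :- p :+ p) refl p q) p≤q)

0≤p⇒q-p≤q : ∀ {p q} → 0ℚ ≤ p → q - p ≤ q
0≤p⇒q-p≤q {p} {q} 0≤p = +-cancelʳ-≤ p (begin
  q - p + p ≡⟨ solve 2 (λ p q → q :- p :+ p := q :+ con 0ℚ) refl p q ⟩
  q + 0ℚ    ≤⟨ +-mono-≤ (≤-refl {q}) 0≤p ⟩
  q + p     ∎)
  where open ≤-Reasoning

triangle⇒bounded : ∀ {a b c} → a ≤ b + c → b ≤ a + c → c ≤ a + b → a + b + c ≤ 1ℚ →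
  0ℚ ≤ a × a ≤ ½
triangle⇒bounded {a} {b} {c} a≤b+c b≤a+c c≤a+b a+b+c≤1 = 0≤a , a≤½
  where
  open ≤-Reasoning
  0≤a : 0ℚ ≤ a
  0≤a = double-cancel-≤ (+-cancelʳ-≤ (b + c) (begin
    0ℚ + 0ℚ + (b + c) ≡⟨ solve 2 (λ b c → con 0ℚ :+ con 0ℚ :+ (b :+ c) := b :+ c) refl b c ⟩
    b + c             ≤⟨ +-mono-≤ b≤a+c c≤a+b ⟩
    a + c + (a + b)   ≡⟨ solve 3 (λ a b c → a :+ c :+ (a :+ b) := a :+ a :+ (b :+ c)) refl a b c ⟩
    a + a + (b + c)   ∎))
  a≤½ : a ≤ ½
  a≤½ = double-cancel-≤ (begin
    a + a       ≤⟨ +-mono-≤ (≤-refl {a}) a≤b+c ⟩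
    a + (b + c) ≡⟨ solve 3 (λ a b c → a :+ (b :+ c) := a :+ b :+ c) refl a b c ⟩
    a + b + c   ≤⟨ a+b+c≤1 ⟩
    ½ + ½       ∎)

half : Bool → ℚ
half true  = ½
half false = 0ℚ

-- On an edge where one of two half-integral points is ½ and the other 0, the segment between
-- them is t ↦ mirror a (t * ½), with a telling which endpoint is ½ (see interpolate-half).
mirror : Bool → ℚ → ℚ
mirror false q = q
mirror true  q = ½ - q

mirror-involutive : ∀ a q → mirror a (mirror a q) ≡ q
mirror-involutive false q = refl
mirror-involutive true  q = solve 1 (λ q → con ½ :- (con ½ :- q) := q) refl q

mirror-injective : ∀ a {p q} → mirror a p ≡ mirror a q → p ≡ q
mirror-injective a {p} {q} eq = begin
  p                      ≡⟨ mirror-involutive a p ⟨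
  mirror a (mirror a p)  ≡⟨ cong (mirror a) eq ⟩
  mirror a (mirror a q)  ≡⟨ mirror-involutive a q ⟩
  q                      ∎
  where open ≡-Reasoning

mirror-bounded : ∀ a {q} → 0ℚ ≤ q → q ≤ ½ → 0ℚ ≤ mirror a q × mirror a q ≤ ½
mirror-bounded false 0≤q q≤½ = 0≤q , q≤½
mirror-bounded true  0≤q q≤½ = p≤q⇒0≤q-p q≤½ , 0≤p⇒q-p≤q 0≤q

interpolate-half : ∀ t a → (1ℚ - t) * half a + t * half (not a) ≡ mirror a (t * ½)
interpolate-half t false =
  solve 1 (λ t → (con 1ℚ :- t) :* con 0ℚ :+ t :* con ½ := t :* con ½) refl t
interpolate-half t true  =
  solve 1 (λ t → (con 1ℚ :- t) :* con ½ :+ t :* con 0ℚ := con ½ :- t :* con ½) refl t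

interpolate-same : ∀ t q → (1ℚ - t) * q + t * q ≡ q
interpolate-same t q = solve 2 (λ t q → (con 1ℚ :- t) :* q :+ t :* q := q) refl t q

*½-injective : ∀ {t u} → t * ½ ≡ u * ½ → t ≡ u
*½-injective {t} {u} eq = begin
  t                   ≡⟨ solve 1 (λ t → t := t :* con ½ :* (con 1ℚ :+ con 1ℚ)) refl t ⟩
  t * ½ * (1ℚ + 1ℚ)   ≡⟨ cong (_* (1ℚ + 1ℚ)) eq ⟩
  u * ½ * (1ℚ + 1ℚ)   ≡⟨ solve 1 (λ u → u :* con ½ :* (con 1ℚ :+ con 1ℚ) := u) refl u ⟩
  u                   ∎
  where open ≡-Reasoning

0ℚ≢1ℚ : 0ℚ ≢ 1ℚ
0ℚ≢1ℚ ()

double-halve : ∀ q → (q + q) * ½ ≡ q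
double-halve q = solve 1 (λ q → (q :+ q) :* con ½ := q) refl q

≤-sandwich : ∀ {x x'} → x ≤ x' + 0ℚ → x' ≤ x + 0ℚ → x ≡ x'
≤-sandwich {x} {x'} x≤x' x'≤x =
  ≤-antisym (subst (x ≤_) (+-identityʳ x') x≤x') (subst (x' ≤_) (+-identityʳ x) x'≤x)

squeeze-½ : ∀ {x x'} → ½ ≤ x + x' → x + x' + ½ ≤ 1ℚ → x + x' ≡ ½
squeeze-½ {x} {x'} ½≤x+x' x+x'+½≤1 = ≤-antisym (+-cancelʳ-≤ ½ x+x'+½≤1) ½≤x+x'

x+y≡½⇒x≡½-y : ∀ {x x'} → x + x' ≡ ½ → x ≡ ½ - x'
x+y≡½⇒x≡½-y {x} {x'} x+x'≡½ = begin
  x              ≡⟨ solve 2 (λ x x' → x := x :+ x' :- x') refl x x' ⟩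
  x + x' - x'    ≡⟨ cong (_- x') x+x'≡½ ⟩
  ½ - x'         ∎
  where open ≡-Reasoning

mirror-propagates : ∀ a a' b {x x' y} → a xor a' xor b ≡ false → y ≡ half b →
  x ≤ x' + y → x' ≤ x + y → y ≤ x + x' → x + x' + y ≤ 1ℚ → mirror a x ≡ mirror a' x'
mirror-propagates false false false _ refl x≤x' x'≤x _ _ = ≤-sandwich x≤x' x'≤x
mirror-propagates true  true  false _ refl x≤x' x'≤x _ _ = cong (mirror true) (≤-sandwich x≤x' x'≤x)
mirror-propagates false true  true  {x} {x'} _ refl _ _ ½≤x+x' x+x'+½≤1 =
  x+y≡½⇒x≡½-y {x} {x'} (squeeze-½ {x} {x'} ½≤x+x' x+x'+½≤1)
mirror-propagates true  false true  {x} {x'} _ refl _ _ ½≤x+x' x+x'+½≤1 =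
  sym (x+y≡½⇒x≡½-y {x'} {x} (trans (+-comm x' x) (squeeze-½ {x} {x'} ½≤x+x' x+x'+½≤1)))

∑ : ∀ {A : Set} → List A → (A → ℚ) → ℚ
∑ xs f = foldr (λ x acc → f x + acc) 0ℚ xs

module _ {A : Set} where

  ∑-cong : ∀ (xs : List A) {f g : A → ℚ} → (∀ x → f x ≡ g x) → ∑ xs f ≡ ∑ xs g
  ∑-cong []       f≡g = refl
  ∑-cong (x ∷ xs) f≡g = cong₂ _+_ (f≡g x) (∑-cong xs f≡g)

  ∑-mono-≤ : ∀ (xs : List A) {f g : A → ℚ} → (∀ x → f x ≤ g x) → ∑ xs f ≤ ∑ xs g
  ∑-mono-≤ []       f≤g = ≤-refl
  ∑-mono-≤ (x ∷ xs) f≤g = +-mono-≤ (f≤g x) (∑-mono-≤ xs f≤g)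

  ∑-tight : ∀ (xs : List A) {f g : A → ℚ} → (∀ x → f x ≤ g x) → ∑ xs f ≡ ∑ xs g →
    ∀ {x} → x ∈ xs → f x ≡ g x
  ∑-tight (y ∷ xs) f≤g eq (here refl) = +-mono-≤-tightˡ (f≤g y) (∑-mono-≤ xs f≤g) eq
  ∑-tight (y ∷ xs) {f} {g} f≤g eq (there x∈xs) =
    ∑-tight xs f≤g (+-mono-≤-tightˡ (∑-mono-≤ xs f≤g) (f≤g y) (trans (+-comm _ (f y)) (trans eq (+-comm (g y) _))))
      x∈xs

  ∑-+ : ∀ (xs : List A) (f g : A → ℚ) → ∑ xs f + ∑ xs g ≡ ∑ xs (λ x → f x + g x)
  ∑-+ []       f g = +-identityˡ 0ℚ
  ∑-+ (x ∷ xs) f g = begin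
    f x + ∑ xs f + (g x + ∑ xs g)
      ≡⟨ solve 4 (λ a b c d → a :+ b :+ (c :+ d) := a :+ c :+ (b :+ d)) refl (f x) (∑ xs f) (g x) (∑ xs g) ⟩
    f x + g x + (∑ xs f + ∑ xs g)   ≡⟨ cong (f x + g x +_) (∑-+ xs f g) ⟩
    f x + g x + ∑ xs (λ x → f x + g x) ∎
    where open ≡-Reasoning

-- The functional exposing the segment between two half-integral vertices, evaluated from the
-- memberships of an edge in the two path collections.
cost : Bool → Bool → ℚ
cost true  true  = 1ℚ
cost false false = - 1ℚ
cost true  false = 0ℚ
cost false true  = 0ℚ

cost-≤ : ∀ a b {y} → 0ℚ ≤ y → y ≤ ½ → cost a b * y ≤ cost a b * half a
cost-≤ true  true  {y} _   y≤½ = subst₂ _≤_ (sym (*-identityˡ y)) (sym (*-identityˡ ½)) y≤½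
cost-≤ false false     0≤y _   = *-monoˡ-≤-nonPos (- 1ℚ) 0≤y
cost-≤ true  false {y} _   _   = ≤-reflexive (trans (*-zeroˡ y) (sym (*-zeroˡ ½)))
cost-≤ false true  {y} _   _   = ≤-reflexive (trans (*-zeroˡ y) (sym (*-zeroˡ 0ℚ)))

cost-half : ∀ a b → cost a b * half a ≡ cost a b * half b
cost-half true  true  = refl
cost-half false false = refl
cost-half true  false = refl
cost-half false true  = refl

cost-tight : ∀ {a b y} → a ≡ b → cost a b * y ≡ cost a b * half a → y ≡ half a
cost-tight {true}  {y = y} refl eq = trans (sym (*-identityˡ y)) eq
cost-tight {false} {y = y} refl eq =
  trans (solve 1 (λ y → y := :- con 1ℚ :* (:- con 1ℚ :* y)) refl y) (cong (- 1ℚ *_) eq)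

half-triangle⇒even : ∀ a b c → half a ≤ half b + half c → half b ≤ half a + half c →
  half c ≤ half a + half b → half a + half b + half c ≤ 1ℚ → a xor b xor c ≡ false
half-triangle⇒even false false false _ _ _ _ = refl
half-triangle⇒even false true  true  _ _ _ _ = refl
half-triangle⇒even true  false true  _ _ _ _ = refl
half-triangle⇒even true  true  false _ _ _ _ = refl
half-triangle⇒even true  false false h _ _ _ = contradiction h (from-no (½ ≤? 0ℚ + 0ℚ))
half-triangle⇒even false true  false _ h _ _ = contradiction h (from-no (½ ≤? 0ℚ + 0ℚ))
half-triangle⇒even false false true  _ _ h _ = contradiction h (from-no (½ ≤? 0ℚ + 0ℚ))
half-triangle⇒even true  true  true  _ _ _ h = contradiction h (from-no (½ + ½ + ½ ≤? 1ℚ))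

half≡mirror-0 : ∀ a → half a ≡ mirror a (0ℚ * ½)
half≡mirror-0 false = refl
half≡mirror-0 true  = refl

half-not≡mirror-1 : ∀ a → half (not a) ≡ mirror a (1ℚ * ½)
half-not≡mirror-1 false = refl
half-not≡mirror-1 true  = refl

module _ {A : Set} where

  lookup-injective : ∀ {xs : List A} → Unique xs → ∀ {i j} → lookup xs i ≡ lookup xs j → i ≡ j
  lookup-injective {_ ∷ _}  _              {Fin.zero}  {Fin.zero}  _  = refl
  lookup-injective {_ ∷ xs} (x∉xs ∷ _)     {Fin.zero}  {Fin.suc j} eq =
    contradiction eq (All.lookup x∉xs (∈-lookup j))
  lookup-injective {_ ∷ xs} (x∉xs ∷ _)     {Fin.suc i} {Fin.zero}  eq =
    contradiction (sym eq) (All.lookup x∉xs (∈-lookup i))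
  lookup-injective {_ ∷ _}  (_ ∷ unique)   {Fin.suc i} {Fin.suc j} eq = cong Fin.suc (lookup-injective unique eq)

  ∈-length≡1⇒≡ : ∀ {xs : List A} {x y} → length xs ≡ 1 → x ∈ xs → y ∈ xs → x ≡ y
  ∈-length≡1⇒≡ {_ ∷ []} refl (here refl) (here refl) = refl

  record TwoOthers (P : A → Set) (x : A) : Set where
    field
      left right : A
      left≢x     : left ≢ x
      right≢x    : right ≢ x
      left≢right : left ≢ right
      P-left     : P left
      P-right    : P right
      covers     : ∀ y → P y → y ≡ x ⊎ y ≡ left ⊎ y ≡ right

  length≡3⇒TwoOthers : ∀ {xs : List A} {x} → Unique xs → length xs ≡ 3 → x ∈ xs →
    TwoOthers (_∈ xs) x
  length≡3⇒TwoOthers {a ∷ b ∷ c ∷ []} ((a≢b ∷ a≢c ∷ []) ∷ (b≢c ∷ []) ∷ [] ∷ []) refl (here refl) = record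
    { left = b ; right = c ; left≢x = ≢-sym a≢b ; right≢x = ≢-sym a≢c ; left≢right = b≢c
    ; P-left = there (here refl) ; P-right = there (there (here refl))
    ; covers = λ { y (here y≡a) → inj₁ y≡a ; y (there (here y≡b)) → inj₂ (inj₁ y≡b)
                 ; y (there (there (here y≡c))) → inj₂ (inj₂ y≡c) } }
  length≡3⇒TwoOthers {a ∷ b ∷ c ∷ []} ((a≢b ∷ a≢c ∷ []) ∷ (b≢c ∷ []) ∷ [] ∷ []) refl (there (here refl)) = record
    { left = a ; right = c ; left≢x = a≢b ; right≢x = ≢-sym b≢c ; left≢right = a≢c
    ; P-left = here refl ; P-right = there (there (here refl))
    ; covers = λ { y (here y≡a) → inj₂ (inj₁ y≡a) ; y (there (here y≡b)) → inj₁ y≡b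
                 ; y (there (there (here y≡c))) → inj₂ (inj₂ y≡c) } }
  length≡3⇒TwoOthers {a ∷ b ∷ c ∷ []} ((a≢b ∷ a≢c ∷ []) ∷ (b≢c ∷ []) ∷ [] ∷ []) refl (there (there (here refl))) = record
    { left = a ; right = b ; left≢x = a≢c ; right≢x = b≢c ; left≢right = a≢b
    ; P-left = here refl ; P-right = there (here refl)
    ; covers = λ { y (here y≡a) → inj₂ (inj₁ y≡a) ; y (there (here y≡b)) → inj₂ (inj₂ y≡b)
                 ; y (there (there (here y≡c))) → inj₁ y≡c } }

  TwoOthers-map : ∀ {P Q : A → Set} {x} → (∀ {y} → P y → Q y) → (∀ {y} → Q y → P y) →
    TwoOthers P x → TwoOthers Q x
  TwoOthers-map P⇒Q Q⇒P others = record
    { left = left ; right = right ; left≢x = left≢x ; right≢x = right≢x ; left≢right = left≢right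
    ; P-left = P⇒Q P-left ; P-right = P⇒Q P-right ; covers = λ y Qy → covers y (Q⇒P Qy) }
    where open TwoOthers others

unique-length≤ : ∀ {n} (xs : List (Fin n)) → Unique xs → length xs ℕ.≤ n
unique-length≤ {n} xs unique with length xs ℕ.≤? n
... | yes ≤n = ≤n
... | no  ≰n with pigeonhole (ℕₚ.≰⇒> ≰n) (lookup xs)
...   | i , j , i<j , eq = contradiction (lookup-injective unique eq) (<⇒≢ i<j)

all-equal⇒≡1 : ∀ {n} (e : Fin n) → (∀ f → f ≡ e) → n ≡ 1
all-equal⇒≡1 {suc zero}    _ _    = refl
all-equal⇒≡1 {suc (suc n)} _ all≡ with trans (all≡ Fin.zero) (sym (all≡ (Fin.suc Fin.zero)))
... | ()

-- Graphs, walks and the polytope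

module _ (G : Graph) where
  open Graph G
  open import Data.List.Membership.DecPropositional (_≟ᶠ_ {nE}) using (_∈?_)

  incidentEdges : V G → List (E G)
  incidentEdges v = filter (λ e → incident? G e v) (allFin nE)

  incident⇒∈ : ∀ {e v} → Incident G e v → e ∈ incidentEdges v
  incident⇒∈ {e} {v} = ∈-filter⁺ (λ e → incident? G e v) (∈-allFin e)

  ∈⇒incident : ∀ {e v} → e ∈ incidentEdges v → Incident G e v
  ∈⇒incident {e} {v} e∈ = proj₂ (∈-filter⁻ (λ e → incident? G e v) {xs = allFin nE} e∈)

  leaf-edge-unique : ∀ {v e f} → Leaf G v → Incident G e v → Incident G f v → e ≡ f
  leaf-edge-unique leaf ie if = ∈-length≡1⇒≡ leaf (incident⇒∈ ie) (incident⇒∈ if)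

  Fork : V G → E G → Set
  Fork v e = TwoOthers (λ f → Incident G f v) e

  fork : ∀ {v e} → degree G v ≡ 3 → Incident G e v → Fork v e
  fork {v} deg3 ie = TwoOthers-map ∈⇒incident incident⇒∈
    (length≡3⇒TwoOthers (filter⁺ (λ e → incident? G e v) (allFin⁺ nE)) deg3 (incident⇒∈ ie))

  third-edge : ∀ {v e f} → degree G v ≡ 3 → e ≢ f → Incident G e v → Incident G f v →
    ∃ λ r → Incident G r v × r ≢ e × r ≢ f
  third-edge deg3 e≢f ie if with fork deg3 ie
  ... | F with TwoOthers.covers F _ if
  ...   | inj₁ f≡e         = contradiction (sym f≡e) e≢f
  ...   | inj₂ (inj₁ refl) = right , P-right , right≢x , ≢-sym left≢right
    where open TwoOthers F
  ...   | inj₂ (inj₂ refl) = left , P-left , left≢x , left≢right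
    where open TwoOthers F

  AtInternalNodes : (E G → E G → E G → Set) → Set
  AtInternalNodes P = ∀ v → degree G v ≡ 3 → ∀ a b c → a ≢ b → a ≢ c → b ≢ c →
    Incident G a v → Incident G b v → Incident G c v → P a b c

  at-fork : ∀ {P v e} → AtInternalNodes P → degree G v ≡ 3 → Incident G e v → (F : Fork v e) →
    P e (TwoOthers.left F) (TwoOthers.right F)
  at-fork {v = v} {e} P-at deg3 ie F =
    P-at v deg3 e left right (≢-sym left≢x) (≢-sym right≢x) left≢right ie P-left P-right
    where open TwoOthers F

  Joins⇒Incidentˡ : ∀ {e u w} → Joins G e u w → Incident G e u
  Joins⇒Incidentˡ (inj₁ (src≡u , _)) = inj₁ src≡u
  Joins⇒Incidentˡ (inj₂ (_ , tgt≡u)) = inj₂ tgt≡u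

  Joins⇒Incidentʳ : ∀ {e u w} → Joins G e u w → Incident G e w
  Joins⇒Incidentʳ (inj₁ (_ , tgt≡w)) = inj₂ tgt≡w
  Joins⇒Incidentʳ (inj₂ (src≡w , _)) = inj₁ src≡w

  Joins-sym : ∀ {e u w} → Joins G e u w → Joins G e w u
  Joins-sym (inj₁ ends) = inj₂ ends
  Joins-sym (inj₂ ends) = inj₁ ends

  Joins-Incident⇒end : ∀ {e u w v} → Joins G e u w → Incident G e v → v ≡ u ⊎ v ≡ w
  Joins-Incident⇒end (inj₁ (refl , refl)) (inj₁ refl) = inj₁ refl
  Joins-Incident⇒end (inj₁ (refl , refl)) (inj₂ refl) = inj₂ refl
  Joins-Incident⇒end (inj₂ (refl , refl)) (inj₁ refl) = inj₂ refl
  Joins-Incident⇒end (inj₂ (refl , refl)) (inj₂ refl) = inj₁ refl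

  start∈walkVertices : ∀ {u w} (p : Walk G u w) → u ∈ walkVertices G p
  start∈walkVertices []           = here refl
  start∈walkVertices (step _ _ _) = here refl

  incident∈walkVertices : ∀ {u w e v} (p : Walk G u w) → e ∈ walkEdges G p → Incident G e v →
    v ∈ walkVertices G p
  incident∈walkVertices (step e j p) (here refl) ie with Joins-Incident⇒end j ie
  ... | inj₁ refl = here refl
  ... | inj₂ refl = there (start∈walkVertices p)
  incident∈walkVertices (step _ _ p) (there e∈p) ie = there (incident∈walkVertices p e∈p ie)

  walkEdges-unique : ∀ {u w} (p : Walk G u w) → Unique (walkVertices G p) → Unique (walkEdges G p)
  walkEdges-unique []           _                  = []
  walkEdges-unique (step e j p) (u∉p ∷ p-unique) =
    All.tabulate (λ { e'∈p refl → All.lookup u∉p (incident∈walkVertices p e'∈p (Joins⇒Incidentˡ j)) refl })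
    ∷ walkEdges-unique p p-unique

  walk-last-edge : ∀ {u w y e} (j : Joins G e u w) (q : Walk G w y) →
    ∃ λ es → ∃ λ e' → walkEdges G (step e j q) ≡ es ++ e' ∷ [] × Incident G e' y
  walk-last-edge {e = e} j []             = [] , e , refl , Joins⇒Incidentʳ j
  walk-last-edge {e = e} j (step _ j' q) with walk-last-edge j' q
  ... | es , e' , edges≡ , ie' = e ∷ es , e' , cong (e ∷_) edges≡ , ie'

  leaf-leaf-edge-only : Connected G → ∀ {e} → Leaf G (src e) → Leaf G (tgt e) → ∀ f → f ≡ e
  leaf-leaf-edge-only connected {e} leaf-src leaf-tgt f =
    leaf-edge-unique (leaf-end e-at-src-f) (inj₁ refl) e-at-src-f
    where
    leaf-end : ∀ {a} → Incident G e a → Leaf G a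
    leaf-end (inj₁ refl) = leaf-src
    leaf-end (inj₂ refl) = leaf-tgt

    stays : ∀ {a b} → Walk G a b → Incident G e a → Incident G e b
    stays []           ie = ie
    stays (step g j p) ie with leaf-edge-unique (leaf-end ie) (Joins⇒Incidentˡ j) ie
    ... | refl = stays p (Joins⇒Incidentʳ j)

    e-at-src-f : Incident G e (src f)
    e-at-src-f = stays (connected (src e) (src f)) (inj₁ refl)

  internal-end : Is13Tree G → ∀ e → nE ≡ 1 ⊎ ∃ λ v → Incident G e v × degree G v ≡ 3
  internal-end ((connected , _) , degree13) e with degree13 (src e) | degree13 (tgt e)
  ... | inj₂ deg3     | _             = inj₂ (src e , inj₁ refl , deg3)
  ... | inj₁ _        | inj₂ deg3     = inj₂ (tgt e , inj₂ refl , deg3)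
  ... | inj₁ leaf-src | inj₁ leaf-tgt = inj₁ (all-equal⇒≡1 e (leaf-leaf-edge-only connected leaf-src leaf-tgt))

  Triangle : Vector G → E G → E G → E G → Set
  Triangle u a b c = (u a ≤ u b + u c) × (u b ≤ u a + u c) × (u c ≤ u a + u b) × (u a + u b + u c ≤ 1ℚ)

  Triangle-cong : ∀ {u u' a b c} → u a ≡ u' a → u b ≡ u' b → u c ≡ u' c →
    Triangle u a b c → Triangle u' a b c
  Triangle-cong ea eb ec t rewrite ea | eb | ec = t

  PT-bounded : Is13Tree G → ∀ {x} → InPT G x → ∀ e → 0ℚ ≤ x e × x e ≤ ½
  PT-bounded tree {x} (single-edge , internal) e with internal-end tree e
  ... | inj₁ nE≡1 = single-edge nE≡1 e
  ... | inj₂ (v , ie , deg3) with at-fork {P = Triangle x} internal deg3 ie (fork deg3 ie)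
  ...   | a≤ , b≤ , c≤ , sum≤ = triangle⇒bounded a≤ b≤ c≤ sum≤

  record Continuation (D : E G → Set) (x : V G) (e : E G) : Set where
    field
      next          : E G
      D-next        : D next
      next≢e        : next ≢ e
      next-incident : Incident G next x
      only          : ∀ g → Incident G g x → D g → g ≡ e ⊎ g ≡ next

  continuation : ∀ {x e n o} (d : E G → Bool) → n ≢ e → Incident G n x → d n ≡ true → d o ≡ false →
    (∀ g → Incident G g x → g ≡ e ⊎ g ≡ n ⊎ g ≡ o) → Continuation (λ g → d g ≡ true) x e
  continuation {x} {e} {n} {o} d n≢e n-inc d-n d-o covers = record
    { next = n ; D-next = d-n ; next≢e = n≢e ; next-incident = n-inc ; only = only }
    where
    only : ∀ g → Incident G g x → d g ≡ true → g ≡ e ⊎ g ≡ n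
    only g ig dg with covers g ig
    ... | inj₁ g≡e         = inj₁ g≡e
    ... | inj₂ (inj₁ g≡n)  = inj₂ g≡n
    ... | inj₂ (inj₂ refl) = contradiction (trans (sym dg) d-o) λ ()

  fork-continuation : ∀ {x e} (d : E G → Bool) (F : Fork x e) →
    d (TwoOthers.left F) xor d (TwoOthers.right F) ≡ true → Continuation (λ g → d g ≡ true) x e
  fork-continuation d F odd with d (TwoOthers.left F) in d-left | d (TwoOthers.right F) in d-right
  ... | true  | false = continuation d left≢x P-left d-left d-right covers
    where open TwoOthers F
  ... | false | true  = continuation d right≢x P-right d-right d-left (λ g ig → Sum.map₂ Sum.swap (covers g ig))
    where open TwoOthers F

  inEdges? : (K : List (LeafPath G)) (e : E G) → Dec (InEdges G K e)
  inEdges? K e = any? (λ P → e ∈? pathEdges G P) K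

  member : List (LeafPath G) → E G → Bool
  member K e = does (inEdges? K e)

  half-indicator : ∀ {u K} → IsHalfIndicator G u K → ∀ e → u e ≡ half (member K e)
  half-indicator {K = K} u-half e with inEdges? K e
  ... | yes e∈K = proj₁ (u-half e) e∈K
  ... | no  e∉K = proj₂ (u-half e) e∉K

  Xor⇔xor : ∀ {A B : Set} (A? : Dec A) (B? : Dec B) → Xor G A B ⇔ (does A? xor does B? ≡ true)
  Xor⇔xor A? B? = mk⇔ (to A? B?) (from A? B?)
    where
    to : ∀ {A B : Set} (A? : Dec A) (B? : Dec B) → Xor G A B → does A? xor does B? ≡ true
    to (yes _) (no _)  _               = refl
    to (no _)  (yes _) _               = refl
    to (yes a) (yes b) (inj₁ (_ , ¬b)) = contradiction b ¬b
    to (yes a) (yes b) (inj₂ (¬a , _)) = contradiction a ¬a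
    to (no ¬a) (no ¬b) (inj₁ (a , _))  = contradiction a ¬a
    to (no ¬a) (no ¬b) (inj₂ (_ , b))  = contradiction b ¬b

    from : ∀ {A B : Set} (A? : Dec A) (B? : Dec B) → does A? xor does B? ≡ true → Xor G A B
    from (yes a)  (no ¬b) _ = inj₁ (a , ¬b)
    from (no ¬a) (yes b)  _ = inj₂ (¬a , b)

  half-InPT⇒even : ∀ {u} (s : E G → Bool) → InPT G u → (∀ e → u e ≡ half (s e)) →
    AtInternalNodes (λ a b c → s a xor s b xor s c ≡ false)
  half-InPT⇒even s (_ , internal) u≡half v deg3 a b c a≢b a≢c b≢c ia ib ic
    with Triangle-cong {u' = half ∘ s} (u≡half a) (u≡half b) (u≡half c)
           (internal v deg3 a b c a≢b a≢c b≢c ia ib ic)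
  ... | a≤ , b≤ , c≤ , sum≤ = half-triangle⇒even (s a) (s b) (s c) a≤ b≤ c≤ sum≤

  override : List (E G) → Vector G → Vector G → Vector G
  override S u u' e = if does (e ∈? S) then u' e else u e

  module _ {S : List (E G)} {u u' : Vector G} where

    override-∈ : ∀ {e} → e ∈ S → override S u u' e ≡ u' e
    override-∈ {e} e∈S with e ∈? S
    ... | yes _   = refl
    ... | no e∉S = contradiction e∈S e∉S

    override-∉ : ∀ {e} → e ∉ S → override S u u' e ≡ u e
    override-∉ {e} e∉S with e ∈? S
    ... | yes e∈S = contradiction e∈S e∉S
    ... | no _    = refl

    override-dot : ∀ c → dot G c (override S u u') + dot G c (override S u' u) ≡ dot G c u + dot G c u'
    override-dot c = begin
      dot G c (override S u u') + dot G c (override S u' u)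
        ≡⟨ ∑-+ (allFin nE) (λ e → c e * override S u u' e) (λ e → c e * override S u' u e) ⟩
      ∑ (allFin nE) (λ e → c e * override S u u' e + c e * override S u' u e)
        ≡⟨ ∑-cong (allFin nE) swapped ⟩
      ∑ (allFin nE) (λ e → c e * u e + c e * u' e)
        ≡⟨ ∑-+ (allFin nE) (λ e → c e * u e) (λ e → c e * u' e) ⟨
      dot G c u + dot G c u' ∎
      where
      open ≡-Reasoning
      swapped : ∀ e → c e * override S u u' e + c e * override S u' u e ≡ c e * u e + c e * u' e
      swapped e with e ∈? S
      ... | yes _ = +-comm (c e * u' e) (c e * u e)
      ... | no _  = refl

    Separated : Set
    Separated = ∀ v → degree G v ≡ 3 →
      (∀ {y} → Incident G y v → y ∉ S) ⊎ (∀ {y} → Incident G y v → y ∉ S → u y ≡ u' y)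

    override-InPT : InPT G u → InPT G u' → Separated → InPT G (override S u u')
    override-InPT (u-single , u-internal) (u'-single , u'-internal) separated = single , internal
      where
      single : nE ≡ 1 → ∀ e → 0ℚ ≤ override S u u' e × override S u u' e ≤ ½
      single nE≡1 e with e ∈? S
      ... | yes _ = u'-single nE≡1 e
      ... | no _  = u-single nE≡1 e

      internal : AtInternalNodes (Triangle (override S u u'))
      internal v deg3 a b c a≢b a≢c b≢c ia ib ic with separated v deg3
      ... | inj₁ outside = Triangle-cong {u' = override S u u'}
          (sym (override-∉ (outside ia))) (sym (override-∉ (outside ib))) (sym (override-∉ (outside ic)))
          (u-internal v deg3 a b c a≢b a≢c b≢c ia ib ic)
      ... | inj₂ agree = Triangle-cong {u' = override S u u'}
          (sym (to-u' ia)) (sym (to-u' ib)) (sym (to-u' ic))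
          (u'-internal v deg3 a b c a≢b a≢c b≢c ia ib ic)
        where
        to-u' : ∀ {y} → Incident G y v → override S u u' y ≡ u' y
        to-u' {y} iy with y ∈? S
        ... | yes _   = refl
        ... | no y∉S = agree iy y∉S

  module _ {A : Set} {D : E G → Set} (g : E G → A)
    (local : ∀ {v e f} → Incident G e v → Incident G f v → e ≢ f → D e → D f → g e ≡ g f) where

    walk-constant-from-first : ∀ {e u w z} (j : Joins G e u w) (q : Walk G w z) →
      All D (walkEdges G (step e j q)) → ∀ {f} → f ∈ walkEdges G (step e j q) → g f ≡ g e
    walk-constant-from-first j q _ (here refl) = refl
    walk-constant-from-first {e} j (step e' j' q) (De ∷ De'∷Ds) (there f∈) with e ≟ᶠ e'
    ... | yes refl = walk-constant-from-first j' q De'∷Ds f∈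
    ... | no e≢e' = trans (walk-constant-from-first j' q De'∷Ds f∈)
                      (sym (local (Joins⇒Incidentʳ j) (Joins⇒Incidentˡ j') e≢e' De (All.head De'∷Ds)))

    walk-constant : ∀ {u z} (p : Walk G u z) → All D (walkEdges G p) →
      ∀ {e f} → e ∈ walkEdges G p → f ∈ walkEdges G p → g e ≡ g f
    walk-constant (step _ j q) Ds e∈ f∈ =
      trans (walk-constant-from-first j q Ds e∈) (sym (walk-constant-from-first j q Ds f∈))

  leafPath-edge : (P : LeafPath G) → ∃ λ e → e ∈ pathEdges G P
  leafPath-edge P with LeafPath.firstLeafEdge P
  ... | e , es , edges≡ , _ = e , subst (e ∈_) (sym edges≡) (here refl)

-- Growing a leaf path inside a subgraph

module Growth (G : Graph) (acyclic : Acyclic G) (D : E G → Set)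
  (continue : ∀ {x e} → ¬ Leaf G x → Incident G e x → D e → Continuation G D x e) where
  open Graph G
  open import Data.List.Membership.DecPropositional (_≟ᶠ_ {nV}) using (_∈?_)

  closed-walk-repeats : ∀ {a b} → a ≡ b → (p : Walk G a b) → walkEdges G p ≢ [] → ¬ Unique (walkEdges G p)
  closed-walk-repeats refl p nonempty unique = nonempty (acyclic _ p unique)

  ClosedAway : ∀ {x y} → Walk G x y → Set
  ClosedAway {x} {y} p = ∀ {v f} → v ∈ walkVertices G p → v ≢ x → v ≢ y → D f → Incident G f v →
    f ∈ walkEdges G p

  record Trail (y : V G) : Set where
    field
      {start second} : V G
      first : E G
      joins : Joins G first start second
      rest  : Walk G second y
    walk : Walk G start y
    walk = step first joins rest
    field
      simple : Unique (walkVertices G walk)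
      in-D   : All D (walkEdges G walk)
      closed : ClosedAway walk

  other-end : ∀ {f x} → Incident G f x → ∃ λ z → Joins G f z x
  other-end {f} (inj₁ src≡x) = tgt f , inj₂ (src≡x , refl)
  other-end {f} (inj₂ tgt≡x) = src f , inj₁ (refl , tgt≡x)

  extend : ∀ {y} (t : Trail y) → ¬ Leaf G (Trail.start t) →
    Σ (Trail y) λ t' → length (walkVertices G (Trail.walk t')) ≡ suc (length (walkVertices G (Trail.walk t)))
  extend {y} t ¬leaf = record { first = next ; joins = z-joins ; rest = walk ; simple = simple′
                              ; in-D = D-next ∷ in-D ; closed = closed′ } , refl
    where
    open Trail t
    open Continuation (continue ¬leaf (Joins⇒Incidentˡ G joins) (All.head in-D))

    z : V G
    z = proj₁ (other-end next-incident)

    z-joins : Joins G next z start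
    z-joins = proj₂ (other-end next-incident)

    next∉walk : next ∉ walkEdges G walk
    next∉walk (here next≡first) = next≢e next≡first
    next∉walk (there next∈rest) =
      All.lookup (AllPairs.head simple) (incident∈walkVertices G rest next∈rest next-incident) refl

    -- z on the trail would close a cycle through start or y, or contradict closedness elsewhere.
    z∉walk : z ∉ walkVertices G walk
    z∉walk z∈walk with z ≟ᶠ start | z ≟ᶠ y
    ... | yes z≡start | _ = closed-walk-repeats z≡start (step next z-joins []) (λ ()) ([] ∷ [])
    ... | no _ | yes z≡y = closed-walk-repeats z≡y (step next z-joins walk) (λ ())
      (¬Any⇒All¬ _ next∉walk ∷ walkEdges-unique G walk simple)
    ... | no z≢start | no z≢y = next∉walk (closed z∈walk z≢start z≢y D-next (Joins⇒Incidentˡ G z-joins))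

    simple′ : Unique (walkVertices G (step next z-joins walk))
    simple′ = ¬Any⇒All¬ _ z∉walk ∷ simple

    closed′ : ClosedAway (step next z-joins walk)
    closed′ (here refl) v≢z _ _ _ = contradiction refl v≢z
    closed′ {v} (there v∈walk) v≢z v≢y Df if with v ≟ᶠ start
    ... | yes refl with only _ if Df
    ...   | inj₁ refl = there (here refl)
    ...   | inj₂ refl = here refl
    closed′ (there v∈walk) v≢z v≢y Df if | no v≢start = there (closed v∈walk v≢start v≢y Df if)

  -- The fuel never runs out: a simple trail has at most nV vertices.
  grow-with-fuel : ∀ {y} k (t : Trail y) → nV ℕ.< length (walkVertices G (Trail.walk t)) ℕ.+ k →
    Σ (Trail y) (Leaf G ∘ Trail.start)
  grow-with-fuel k t bound with degree G (Trail.start t) ℕ.≟ 1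
  ... | yes leaf = t , leaf
  grow-with-fuel zero t bound | no _ =
    contradiction (unique-length≤ _ (Trail.simple t)) (ℕₚ.<⇒≱ (subst (nV ℕ.<_) (ℕₚ.+-identityʳ _) bound))
  grow-with-fuel (suc k) t bound | no ¬leaf with extend t ¬leaf
  ... | t′ , longer =
    grow-with-fuel k t′ (subst (nV ℕ.<_) (trans (ℕₚ.+-suc _ k) (cong (ℕ._+ k) (sym longer))) bound)

  edge-trail : ∀ {e u w} → Joins G e u w → D e → Trail w
  edge-trail {e} {u} {w} j De = record
    { first = e ; joins = j ; rest = [] ; simple = (u≢w ∷ []) ∷ [] ∷ [] ; in-D = De ∷ []
    ; closed = λ { (here refl) u≢u _ _ _ → contradiction refl u≢u
                 ; (there (here refl)) _ w≢w _ _ → contradiction refl w≢w } }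
    where
    u≢w : u ≢ w
    u≢w u≡w = closed-walk-repeats u≡w (step e j []) (λ ()) ([] ∷ [])

  grow-to-leaf : ∀ {y} → Trail y → Σ (Trail y) (Leaf G ∘ Trail.start)
  grow-to-leaf t = grow-with-fuel nV t (ℕₚ.m<n+m nV (ℕ.s≤s ℕ.z≤n))

  Closed : LeafPath G → Set
  Closed P = ∀ {v f} → v ∈ pathVertices G P → D f → Incident G f v → f ∈ pathEdges G P

  -- Grow from e until a leaf ℓ₁ is reached, then grow once more from the edge at ℓ₁.
  closed-leaf-path : ∀ {e} → D e → Σ (LeafPath G) λ P → All D (pathEdges G P) × Closed P
  closed-leaf-path De with grow-to-leaf (edge-trail (inj₁ (refl , refl)) De)
  ... | t₁ , leaf₁ with grow-to-leaf (edge-trail (Joins-sym G (Trail.joins t₁)) (All.head (Trail.in-D t₁)))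
  ...   | t₂ , leaf₂ with walk-last-edge G (Trail.joins t₂) (Trail.rest t₂)
  ...     | es , last , edges≡ , last-incident = P , Trail.in-D t₂ , P-closed
    where
    open Trail t₂
    P : LeafPath G
    P = record
      { walk = walk ; isPath = simple
      ; firstLeafEdge = first , walkEdges G rest , refl , (start , Joins⇒Incidentˡ G joins , leaf₂)
      ; lastLeafEdge  = es , last , edges≡ , (Trail.start t₁ , last-incident , leaf₁) }

    P-closed : Closed P
    P-closed {v} v∈P Df if with v ≟ᶠ start | v ≟ᶠ Trail.start t₁
    ... | yes refl | _ =
      subst (_∈ walkEdges G walk) (leaf-edge-unique G leaf₂ (Joins⇒Incidentˡ G joins) if) (here refl)
    ... | no _ | yes refl = subst (_∈ walkEdges G walk) (leaf-edge-unique G leaf₁ last-incident if)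
                              (subst (last ∈_) (sym edges≡) (∈-++⁺ʳ es (here refl)))
    ... | no v≢start | no v≢end = closed v∈P v≢start v≢end Df if

-- Two half-integral points of the polytope

module SymmetricDifference (T : Graph) (tree : Is13Tree T) {w w' : Vector T} {H H' : List (LeafPath T)}
  (w∈PT : InPT T w) (w'∈PT : InPT T w') (w-half : IsHalfIndicator T w H) (w'-half : IsHalfIndicator T w' H')
  where
  open Graph T

  inH inH' δ : E T → Bool
  inH  = member T H
  inH' = member T H'
  δ e = inH e xor inH' e

  Δ : E T → Set
  Δ e = δ e ≡ true

  w≡half : ∀ e → w e ≡ half (inH e)
  w≡half = half-indicator T w-half

  w'≡half : ∀ e → w' e ≡ half (inH' e)
  w'≡half = half-indicator T w'-half

  w≡w'-off-Δ : ∀ {e} → δ e ≡ false → w e ≡ w' e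
  w≡w'-off-Δ {e} even = trans (w≡half e) (trans (cong half (xor-false⇒≡ {inH e} even)) (sym (w'≡half e)))

  w'≡half-not : ∀ {e} → Δ e → w' e ≡ half (not (inH e))
  w'≡half-not {e} Δe = trans (w'≡half e) (cong half (xor-true⇒not {inH e} Δe))

  segment-on-Δ : ∀ {e} t → Δ e → (1ℚ - t) * w e + t * w' e ≡ mirror (inH e) (t * ½)
  segment-on-Δ {e} t Δe = begin
    (1ℚ - t) * w e + t * w' e
      ≡⟨ cong₂ (λ p q → (1ℚ - t) * p + t * q) (w≡half e) (w'≡half-not Δe) ⟩
    (1ℚ - t) * half (inH e) + t * half (not (inH e))   ≡⟨ interpolate-half t (inH e) ⟩
    mirror (inH e) (t * ½)                             ∎
    where open ≡-Reasoning

  δ-even : AtInternalNodes T (λ a b c → δ a xor δ b xor δ c ≡ false)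
  δ-even v deg3 a b c a≢b a≢c b≢c ia ib ic = xor-even {inH a} {inH b} {inH c} {inH' a} {inH' b} {inH' c}
    (half-InPT⇒even T inH  w∈PT  w≡half  v deg3 a b c a≢b a≢c b≢c ia ib ic)
    (half-InPT⇒even T inH' w'∈PT w'≡half v deg3 a b c a≢b a≢c b≢c ia ib ic)

  ¬leaf⇒degree≡3 : ∀ {v} → ¬ Leaf T v → degree T v ≡ 3
  ¬leaf⇒degree≡3 {v} ¬leaf with proj₂ tree v
  ... | inj₁ leaf = contradiction leaf ¬leaf
  ... | inj₂ deg3 = deg3

  Δ-continues : ∀ {x e} → ¬ Leaf T x → Incident T e x → Δ e → Continuation T Δ x e
  Δ-continues {x} {e} ¬leaf ie Δe = fork-continuation T δ F
    (even-true⇒odd {δ e} {δ (TwoOthers.left F)} {δ (TwoOthers.right F)} δ-even-at-F Δe)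
    where
    F : Fork T x e
    F = fork T (¬leaf⇒degree≡3 ¬leaf) ie
    δ-even-at-F : δ e xor δ (TwoOthers.left F) xor δ (TwoOthers.right F) ≡ false
    δ-even-at-F = at-fork T {P = λ a b c → δ a xor δ b xor δ c ≡ false} δ-even (¬leaf⇒degree≡3 ¬leaf) ie F

  Δ-nonempty : ¬ (∀ e → w e ≡ w' e) → ∃ Δ
  Δ-nonempty w≢w' with ¬∀⟶∃¬ nE (λ e → w e ≡ w' e) (λ e → w e ≟ℚ w' e) w≢w'
  ... | e , we≢w'e with δ e in δe
  ...   | true  = e , δe
  ...   | false = contradiction (w≡w'-off-Δ δe) we≢w'e

  Xor⇔Δ : ∀ e → Xor T (InEdges T H e) (InEdges T H' e) ⇔ Δ e
  Xor⇔Δ e = Xor⇔xor T (inEdges? T H e) (inEdges? T H' e)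

  EdgeSet≡Δ : LeafPath T → Set
  EdgeSet≡Δ P = ∀ e → (e ∈ pathEdges T P → Δ e) × (Δ e → e ∈ pathEdges T P)

  open Growth T (proj₂ (proj₁ tree)) Δ Δ-continues using (Closed; closed-leaf-path)

  module Forward (adjacent : Adjacent T w w') (P : LeafPath T)
    (P-in-Δ : All Δ (pathEdges T P)) (P-closed : Closed P) where
    open import Data.List.Membership.DecPropositional (_≟ᶠ_ {nE}) using (_∈?_)
    open import Data.List.Membership.DecPropositional (_≟ᶠ_ {nV}) using () renaming (_∈?_ to _∈ᵛ?_)

    S : List (E T)
    S = pathEdges T P

    separated : Separated T {S} {w} {w'}
    separated v _ with v ∈ᵛ? pathVertices T P
    ... | yes v∈P = inj₂ λ {y} iy y∉P → w≡w'-off-Δ (¬-not (λ Δy → y∉P (P-closed v∈P Δy iy)))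
    ... | no  v∉P = inj₁ λ iy y∈P → v∉P (incident∈walkVertices T (LeafPath.walk P) y∈P iy)

    separated-sym : Separated T {S} {w'} {w}
    separated-sym v deg3 = Sum.map₂ (λ agree iy y∉P → sym (agree iy y∉P)) (separated v deg3)

    m₁ m₂ : Vector T
    m₁ = override T S w w'
    m₂ = override T S w' w

    m₁∈PT : InPT T m₁
    m₁∈PT = override-InPT T w∈PT w'∈PT separated

    m₂∈PT : InPT T m₂
    m₂∈PT = override-InPT T w'∈PT w∈PT separated-sym

    c : Vector T
    c = proj₁ adjacent

    m₁-optimal : dot T c m₁ ≡ dot T c w
    m₁-optimal with proj₂ adjacent
    ... | maximal , c-w≡c-w' , _ = +-mono-≤-tightˡ (maximal m₁ m₁∈PT)
      (subst (dot T c m₂ ≤_) c-w≡c-w' (maximal m₂ m₂∈PT)) (override-dot T {S} {w} {w'} c)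

    m₁-segment : InSegment T w w' m₁
    m₁-segment = proj₂ (proj₂ (proj₂ adjacent)) m₁ m₁∈PT m₁-optimal

    t : ℚ
    t = proj₁ m₁-segment

    m₁-on-Δ : ∀ {e} → Δ e → m₁ e ≡ mirror (inH e) (t * ½)
    m₁-on-Δ {e} Δe = trans (proj₂ (proj₂ (proj₂ m₁-segment)) e) (segment-on-Δ t Δe)

    covers-Δ : ∀ {g} → Δ g → g ∈ S
    covers-Δ {g} Δg with g ∈? S
    ... | yes g∈P = g∈P
    ... | no  g∉P = contradiction (trans (sym t≡0) t≡1) 0ℚ≢1ℚ
      where
      e₀ : E T
      e₀ = proj₁ (leafPath-edge T P)
      e₀∈P : e₀ ∈ S
      e₀∈P = proj₂ (leafPath-edge T P)
      Δe₀ : Δ e₀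
      Δe₀ = All.lookup P-in-Δ e₀∈P
      t≡0 : t ≡ 0ℚ
      t≡0 = *½-injective (mirror-injective (inH g) (begin
        mirror (inH g) (t * ½)     ≡⟨ m₁-on-Δ Δg ⟨
        m₁ g                       ≡⟨ override-∉ T {S} {w} {w'} g∉P ⟩
        w g                        ≡⟨ w≡half g ⟩
        half (inH g)               ≡⟨ half≡mirror-0 (inH g) ⟩
        mirror (inH g) (0ℚ * ½)    ∎))
        where open ≡-Reasoning
      t≡1 : t ≡ 1ℚ
      t≡1 = *½-injective (mirror-injective (inH e₀) (begin
        mirror (inH e₀) (t * ½)    ≡⟨ m₁-on-Δ Δe₀ ⟨
        m₁ e₀                      ≡⟨ override-∈ T {S} {w} {w'} e₀∈P ⟩
        w' e₀                      ≡⟨ w'≡half-not Δe₀ ⟩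
        half (not (inH e₀))        ≡⟨ half-not≡mirror-1 (inH e₀) ⟩
        mirror (inH e₀) (1ℚ * ½)   ∎))
        where open ≡-Reasoning

  adjacent⇒Δ-leaf-path : Adjacent T w w' → ¬ (∀ e → w e ≡ w' e) → ∃ EdgeSet≡Δ
  adjacent⇒Δ-leaf-path adjacent w≢w' = Δ-path (closed-leaf-path (proj₂ (Δ-nonempty w≢w')))
    where
    Δ-path : (Σ (LeafPath T) λ P → All Δ (pathEdges T P) × Closed P) → ∃ EdgeSet≡Δ
    Δ-path (P , P-in-Δ , P-closed) = P , λ e → All.lookup P-in-Δ , Forward.covers-Δ adjacent P P-in-Δ P-closed

  module Backward (P : LeafPath T) (P≡Δ : EdgeSet≡Δ P) where

    c : Vector T
    c e = cost (inH e) (inH' e)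

    c-pointwise : ∀ {x} → InPT T x → ∀ e → c e * x e ≤ c e * w e
    c-pointwise {x} x∈PT e = subst (λ q → c e * x e ≤ c e * q) (sym (w≡half e))
      (cost-≤ (inH e) (inH' e) {x e} (proj₁ (PT-bounded T tree x∈PT e)) (proj₂ (PT-bounded T tree x∈PT e)))

    c-maximal : ∀ x → InPT T x → dot T c x ≤ dot T c w
    c-maximal x x∈PT = ∑-mono-≤ (allFin nE) (c-pointwise x∈PT)

    c-balanced : dot T c w ≡ dot T c w'
    c-balanced = ∑-cong (allFin nE) λ e → begin
      c e * w e             ≡⟨ cong (c e *_) (w≡half e) ⟩
      c e * half (inH e)    ≡⟨ cost-half (inH e) (inH' e) ⟩
      c e * half (inH' e)   ≡⟨ cong (c e *_) (w'≡half e) ⟨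
      c e * w' e            ∎
      where open ≡-Reasoning

    module Face {x : Vector T} (x∈PT : InPT T x) (optimal : dot T c x ≡ dot T c w) where

      x≡w-off-Δ : ∀ {e} → δ e ≡ false → x e ≡ w e
      x≡w-off-Δ {e} even = trans
        (cost-tight (xor-false⇒≡ {inH e} even)
          (trans (∑-tight (allFin nE) (c-pointwise x∈PT) optimal (∈-allFin e)) (cong (c e *_) (w≡half e))))
        (sym (w≡half e))

      mirrored-step : ∀ {v e f} → Incident T e v → Incident T f v → e ≢ f → Δ e → Δ f →
        mirror (inH e) (x e) ≡ mirror (inH f) (x f)
      mirrored-step {v} {e} {f} ie if e≢f Δe Δf = via (third-edge T deg3 e≢f ie if)
        where
        deg3 : degree T v ≡ 3
        deg3 = ¬leaf⇒degree≡3 λ leaf → e≢f (leaf-edge-unique T leaf ie if)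

        via : (∃ λ r → Incident T r v × r ≢ e × r ≢ f) → mirror (inH e) (x e) ≡ mirror (inH f) (x f)
        via (r , ir , r≢e , r≢f) with proj₂ x∈PT v deg3 e f r e≢f (≢-sym r≢e) (≢-sym r≢f) ie if ir
        ... | e≤ , f≤ , r≤ , sum≤ =
          mirror-propagates (inH e) (inH f) (inH r) inH-even x-r e≤ f≤ r≤ sum≤
          where
          inH-even : inH e xor inH f xor inH r ≡ false
          inH-even = half-InPT⇒even T inH w∈PT w≡half v deg3 e f r e≢f (≢-sym r≢e) (≢-sym r≢f) ie if ir
          x-r : x r ≡ half (inH r)
          x-r = trans (x≡w-off-Δ (even-true-true⇒false {δ e} {δ f}
                  (δ-even v deg3 e f r e≢f (≢-sym r≢e) (≢-sym r≢f) ie if ir) Δe Δf)) (w≡half r)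

      P-in-Δ : All Δ (pathEdges T P)
      P-in-Δ = All.tabulate (proj₁ (P≡Δ _))

      e₀ : E T
      e₀ = proj₁ (leafPath-edge T P)

      κ : ℚ
      κ = mirror (inH e₀) (x e₀)

      mirrored-constant : ∀ {e} → e ∈ pathEdges T P → mirror (inH e) (x e) ≡ κ
      mirrored-constant e∈P = walk-constant T (λ e → mirror (inH e) (x e)) mirrored-step
        (LeafPath.walk P) P-in-Δ e∈P (proj₂ (leafPath-edge T P))

      t : ℚ
      t = κ + κ

      κ-bounded : 0ℚ ≤ κ × κ ≤ ½
      κ-bounded = mirror-bounded (inH e₀) (proj₁ (PT-bounded T tree x∈PT e₀)) (proj₂ (PT-bounded T tree x∈PT e₀))

      x-on-segment : ∀ e → x e ≡ (1ℚ - t) * w e + t * w' e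
      x-on-segment e with δ e in δe
      ... | true = begin
        x e                                      ≡⟨ mirror-involutive (inH e) (x e) ⟨
        mirror (inH e) (mirror (inH e) (x e))    ≡⟨ cong (mirror (inH e)) (mirrored-constant (proj₂ (P≡Δ e) δe)) ⟩
        mirror (inH e) κ                         ≡⟨ cong (mirror (inH e)) (double-halve κ) ⟨
        mirror (inH e) (t * ½)                   ≡⟨ segment-on-Δ t δe ⟨
        (1ℚ - t) * w e + t * w' e                ∎
        where open ≡-Reasoning
      ... | false = begin
        x e                                      ≡⟨ x≡w-off-Δ δe ⟩
        w e                                      ≡⟨ interpolate-same t (w e) ⟨
        (1ℚ - t) * w e + t * w e                 ≡⟨ cong (λ q → (1ℚ - t) * w e + t * q) (w≡w'-off-Δ δe) ⟩
        (1ℚ - t) * w e + t * w' e                ∎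
        where open ≡-Reasoning

      x∈segment : InSegment T w w' x
      x∈segment = t , +-mono-≤ (proj₁ κ-bounded) (proj₁ κ-bounded) , +-mono-≤ (proj₂ κ-bounded) (proj₂ κ-bounded)
                    , x-on-segment

    adjacent : Adjacent T w w'
    adjacent = c , c-maximal , c-balanced , λ x x∈PT optimal → Face.x∈segment x∈PT optimal

  Δ-leaf-path⇒adjacent : ∃ EdgeSet≡Δ → Adjacent T w w'
  Δ-leaf-path⇒adjacent (P , P≡Δ) = Backward.adjacent P P≡Δ

theorem5 : (T : Graph) → Is13Tree T →
    (w w' : Vector T) → IsVertexPT T w → IsVertexPT T w' → ¬ (∀ e → w e ≡ w' e) →
    (H H' : List (LeafPath T)) → DisjointLeafPaths T H → DisjointLeafPaths T H' →
    IsHalfIndicator T w H → IsHalfIndicator T w' H' →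
    Adjacent T w w' ⇔
      (∃ λ (P : LeafPath T) → ∀ e → (e ∈ pathEdges T P → Xor T (InEdges T H e) (InEdges T H' e)) ×
                                      (Xor T (InEdges T H e) (InEdges T H' e) → e ∈ pathEdges T P))
theorem5 T tree w w' (w∈PT , _) (w'∈PT , _) w≢w' H H' _ _ w-half w'-half =
  mk⇔ (via-Xor ∘ λ adjacent → adjacent⇒Δ-leaf-path adjacent w≢w') (Δ-leaf-path⇒adjacent ∘ via-Δ)
  where
  open SymmetricDifference T tree w∈PT w'∈PT w-half w'-half
  open Equivalence

  EdgeSet≡Xor : LeafPath T → Set
  EdgeSet≡Xor P = ∀ e → (e ∈ pathEdges T P → Xor T (InEdges T H e) (InEdges T H' e)) ×
                      (Xor T (InEdges T H e) (InEdges T H' e) → e ∈ pathEdges T P)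

  via-Xor : ∃ EdgeSet≡Δ → ∃ EdgeSet≡Xor
  via-Xor (P , P≡Δ) = P , λ e → from (Xor⇔Δ e) ∘ proj₁ (P≡Δ e) , proj₂ (P≡Δ e) ∘ to (Xor⇔Δ e)

  via-Δ : ∃ EdgeSet≡Xor → ∃ EdgeSet≡Δ
  via-Δ (P , P≡Δ) = P , λ e → to (Xor⇔Δ e) ∘ proj₁ (P≡Δ e) , proj₂ (P≡Δ e) ∘ from (Xor⇔Δ e)
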